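{- Let $\mathcal X$ be a zero-nonzero pattern and let $\mathcal X'$ be obtained by appending a column to $\mathcal X$ whose zero set is the intersection of the zero sets of some subset of the columns of $\mathcal X$. Then $\operatorname{mr}\mathcal R(\mathcal X')=\operatorname{mr}\mathcal R(\mathcal X)$.
   Context: A zero-nonzero pattern is a matrix with entries in $\{0,*\}$. The zero set of a row is the set of column labels where it has entry $0$; the zero set of a column is the set of row labels where it has entry $0$. For a pattern $\mathcal X$, $\mathcal R(\mathcal X)$ is the set of matroids on the set of column labels of $\mathcal X$ such that the zero set of every row of $\mathcal X$ is a flat, and $\operatorname{mr}\mathcal R(\mathcal X)$ is the smallest rank of a matroid in $\mathcal R(\mathcal X)$. -}

module Defs where

open import Data.Nat using (ℕ; suc; _≤_; _<_)
open import Data.Fin using (Fin; fromℕ; inject₁)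
open import Data.Fin.Subset using (Subset; _∈_; _∉_; _⊆_; _∪_; ⁅_⁆; ∣_∣; ⊤) renaming (⊥ to ∅)
open import Data.Product using (Σ; _×_; ∃)
open import Relation.Binary.PropositionalEquality using (_≡_)
open import Level using () renaming (suc to lsuc; zero to lzero)

data Entry : Set where
  zero : Entry
  star : Entry

Pattern : ℕ → ℕ → Set
Pattern m n = Fin m → Fin n → Entry

InRowZeroSet : ∀ {m n} → Pattern m n → Fin m → Fin n → Set
InRowZeroSet X i j = X i j ≡ zero

IsRowZeroSet : ∀ {m n} → Pattern m n → Fin m → Subset n → Set
IsRowZeroSet X i Z = ∀ j → (j ∈ Z → X i j ≡ zero) × (X i j ≡ zero → j ∈ Z)

IsColZeroSet : ∀ {m n} → Pattern m n → Fin n → Subset m → Set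
IsColZeroSet X j Z = ∀ i → (i ∈ Z → X i j ≡ zero) × (X i j ≡ zero → i ∈ Z)

record Matroid (n : ℕ) : Set₁ where
  field
    Indep     : Subset n → Set
    indep-∅   : Indep ∅
    indep-⊆   : ∀ {I J} → I ⊆ J → Indep J → Indep I
    augment   : ∀ {I J} → Indep I → Indep J → ∣ I ∣ < ∣ J ∣ →
                Σ (Fin n) λ e → e ∈ J × e ∉ I × Indep (I ∪ ⁅ e ⁆)

open Matroid public

IsRankOf : ∀ {n} → Matroid n → Subset n → ℕ → Set
IsRankOf M A k =
  (Σ (Subset _) λ I → I ⊆ A × Indep M I × ∣ I ∣ ≡ k) ×
  (∀ I → I ⊆ A → Indep M I → ∣ I ∣ ≤ k)

IsRank : ∀ {n} → Matroid n → ℕ → Set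
IsRank M k = IsRankOf M ⊤ k

IsFlat : ∀ {n} → Matroid n → Subset n → Set
IsFlat M F = ∀ e → e ∉ F → ∀ k k' →
  IsRankOf M F k → IsRankOf M (F ∪ ⁅ e ⁆) k' → k < k'

InR : ∀ {m n} → Pattern m n → Matroid n → Set
InR X M = ∀ i Z → IsRowZeroSet X i Z → IsFlat M Z

IsMR : ∀ {m n} → Pattern m n → ℕ → Set₁
IsMR {n = n} X k =
  (Σ (Matroid n) λ M → InR X M × IsRank M k) ×
  (∀ (M : Matroid n) k' → InR X M → IsRank M k' → k ≤ k')

-- X' is X with one column appended (new column has label fromℕ n, the
-- old column j has label inject₁ j).
AppendsColumn : ∀ {m n} → Pattern m n → Pattern m (suc n) → Set
AppendsColumn {n = n} X X' = ∀ i j → X' i (inject₁ j) ≡ X i j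

-- The zero set of the new column is the intersection of the zero sets of
-- the columns of X indexed by S (empty intersection = all rows).
NewColumnIsIntersection : ∀ {m n} → Pattern m n → Pattern m (suc n) → Subset n → Set
NewColumnIsIntersection {n = n} X X' S =
  ∀ i → ((X' i (fromℕ n) ≡ zero) → (∀ j → j ∈ S → X i j ≡ zero)) ×
        ((∀ j → j ∈ S → X i j ≡ zero) → (X' i (fromℕ n) ≡ zero))

module Submission where

-- Deleting the new element e from a matroid in ℛ(X') leaves a matroid in ℛ(X) of no larger rank,
-- so mr ℛ(X) ≤ mr ℛ(X'). Conversely, extend a matroid M ∈ ℛ(X) of minimum rank by e placed freely
-- on the closure of S: I ∪ {e} is independent iff I ∪ {s} is for some s ∈ S outside I. This keeps
-- the rank, turns a flat Z of M into the flat Z ∪ {e} when S ⊆ Z and keeps it a flat otherwise,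
-- and these are exactly the row zero sets of X'.
-- Minimum ranks exist constructively: matroids with decidable independence on a finite set can be
-- enumerated, and for a decidable conclusion such as k ≤ k' every matroid may be assumed decidable.

open import Defs
open import Data.Bool using (Bool; true; false; T; T?; _∨_)
open import Data.Bool.Properties using (∨-identityʳ; ∨-zeroʳ)
open import Data.Fin using (Fin; zero; suc; fromℕ; inject₁)
open import Data.Fin.Properties using (any?; all?)
open import Data.Fin.Relation.Unary.Top using (view; ‵fromℕ; ‵inject₁)
open import Data.Fin.Subset using (Subset; _∈_; _∉_; _⊆_; _∪_; ⁅_⁆; ∣_∣; ⊤; inside; outside)
  renaming (⊥ to ∅)
open import Data.Fin.Subset.Properties
open import Data.Nat using (ℕ; zero; suc; _+_; _≤_; _<_; z≤n; s≤s; s<s⁻¹; _≤?_; _≟_)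
open import Data.Nat.Properties
  using (<⇒≱; ≰⇒>; ≤-antisym; ≤-refl; n<1+n; <-trans; ≤-trans; m≤m+n; +-suc; module ≤-Reasoning)
open import Data.Product using (Σ; ∃; _×_; _,_; proj₁; proj₂)
open import Data.Sum using (_⊎_; inj₁; inj₂; [_,_]′)
open import Data.Vec using ([]; _∷_; _∷ʳ_; here; there; tabulate; init; last; initLast)
open import Data.Vec.Properties using ([]=⇒lookup; lookup⇒[]=; lookup∘tabulate; init-∷ʳ; last-∷ʳ)
open import Data.Unit using (tt) renaming (⊤ to Unit)
open import Function using (_∘_; id; _⇔_; mk⇔; Equivalence)
open import Relation.Nullary using (¬_; Dec; yes; no; isYes; contradiction; ¬?)
open import Relation.Nullary.Decidable
  using (_×-dec_; _⊎-dec_; _→-dec_; map′; decidable-stable; ¬¬-excluded-middle; toWitness; fromWitness)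
open import Relation.Unary using (Decidable; _≐_)
open import Relation.Nullary.Negation using (¬¬-map)
open import Relation.Binary.PropositionalEquality
  using (_≡_; _≢_; refl; sym; trans; cong; cong₂; subst; subst₂; module ≡-Reasoning)

∣p∪⁅x⁆∣≡1+∣p∣ : ∀ {n} {x : Fin n} (p : Subset n) → x ∉ p → ∣ p ∪ ⁅ x ⁆ ∣ ≡ suc ∣ p ∣
∣p∪⁅x⁆∣≡1+∣p∣ {x = zero}  (outside ∷ p) _   = cong (suc ∘ ∣_∣) (∪-identityʳ p)
∣p∪⁅x⁆∣≡1+∣p∣ {x = zero}  (inside ∷ p)  x∉p = contradiction here x∉p
∣p∪⁅x⁆∣≡1+∣p∣ {x = suc x} (outside ∷ p) x∉p = ∣p∪⁅x⁆∣≡1+∣p∣ p (x∉p ∘ there)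
∣p∪⁅x⁆∣≡1+∣p∣ {x = suc x} (inside ∷ p)  x∉p = cong suc (∣p∪⁅x⁆∣≡1+∣p∣ p (x∉p ∘ there))

x∈p∪⁅y⁆⁻ : ∀ {n} (p : Subset n) {x y : Fin n} → x ∈ p ∪ ⁅ y ⁆ → x ∈ p ⊎ x ≡ y
x∈p∪⁅y⁆⁻ p {y = y} x∈ with x∈p∪q⁻ p ⁅ y ⁆ x∈
... | inj₁ x∈p  = inj₁ x∈p
... | inj₂ x∈⁅y⁆ = inj₂ (x∈⁅y⁆⇒x≡y y x∈⁅y⁆)

x∈p∪⁅x⁆ : ∀ {n} (p : Subset n) (x : Fin n) → x ∈ p ∪ ⁅ x ⁆
x∈p∪⁅x⁆ p x = x∈p∪q⁺ (inj₂ (x∈⁅x⁆ x))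

x∉p∪⁅y⁆ : ∀ {n} {p : Subset n} {x y : Fin n} → x ∉ p → x ≢ y → x ∉ p ∪ ⁅ y ⁆
x∉p∪⁅y⁆ {p = p} x∉p x≢y x∈ with x∈p∪⁅y⁆⁻ p x∈
... | inj₁ x∈p = x∉p x∈p
... | inj₂ x≡y = x≢y x≡y

p∪⁅x⁆⊆q : ∀ {n} {p q : Subset n} {x : Fin n} → p ⊆ q → x ∈ q → p ∪ ⁅ x ⁆ ⊆ q
p∪⁅x⁆⊆q {p = p} p⊆q x∈q y∈ with x∈p∪⁅y⁆⁻ p y∈
... | inj₁ y∈p = p⊆q y∈p
... | inj₂ refl = x∈q

∪⁅⁆-monoˡ : ∀ {n} {p q : Subset n} (x : Fin n) → p ⊆ q → p ∪ ⁅ x ⁆ ⊆ q ∪ ⁅ x ⁆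
∪⁅⁆-monoˡ {q = q} x p⊆q = p∪⁅x⁆⊆q (p⊆p∪q ⁅ x ⁆ ∘ p⊆q) (x∈p∪⁅x⁆ q x)

∪⁅⁆-swap : ∀ {n} (p : Subset n) (x y : Fin n) → (p ∪ ⁅ x ⁆) ∪ ⁅ y ⁆ ≡ (p ∪ ⁅ y ⁆) ∪ ⁅ x ⁆
∪⁅⁆-swap p x y = begin
  (p ∪ ⁅ x ⁆) ∪ ⁅ y ⁆  ≡⟨ ∪-assoc p ⁅ x ⁆ ⁅ y ⁆ ⟩
  p ∪ (⁅ x ⁆ ∪ ⁅ y ⁆)  ≡⟨ cong (p ∪_) (∪-comm ⁅ x ⁆ ⁅ y ⁆) ⟩
  p ∪ (⁅ y ⁆ ∪ ⁅ x ⁆)  ≡⟨ sym (∪-assoc p ⁅ y ⁆ ⁅ x ⁆) ⟩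
  (p ∪ ⁅ y ⁆) ∪ ⁅ x ⁆  ∎
  where open ≡-Reasoning

p⊈q⇒∃∈p∉q : ∀ {n} {p q : Subset n} → ¬ p ⊆ q → ∃ λ x → x ∈ p × x ∉ q
p⊈q⇒∃∈p∉q {p = p} {q} p⊈q with any? (λ x → x ∈? p ×-dec ¬? (x ∈? q))
... | yes witness = witness
... | no none     = contradiction (λ {x} → p⊆q {x}) p⊈q
  where
  p⊆q : p ⊆ q
  p⊆q {x} x∈p = decidable-stable (x ∈? q) (λ x∉q → none (x , x∈p , x∉q))

-- Subsets of Fin (suc n) split off at their last element fromℕ n

∣p∷ʳoutside∣ : ∀ {n} (p : Subset n) → ∣ p ∷ʳ outside ∣ ≡ ∣ p ∣
∣p∷ʳoutside∣ []            = refl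
∣p∷ʳoutside∣ (outside ∷ p) = ∣p∷ʳoutside∣ p
∣p∷ʳoutside∣ (inside ∷ p)  = cong suc (∣p∷ʳoutside∣ p)

∣p∷ʳinside∣ : ∀ {n} (p : Subset n) → ∣ p ∷ʳ inside ∣ ≡ suc ∣ p ∣
∣p∷ʳinside∣ []            = refl
∣p∷ʳinside∣ (outside ∷ p) = ∣p∷ʳinside∣ p
∣p∷ʳinside∣ (inside ∷ p)  = cong suc (∣p∷ʳinside∣ p)

inject₁∈∷ʳ⁺ : ∀ {n} {p : Subset n} {b} {j : Fin n} → j ∈ p → inject₁ j ∈ p ∷ʳ b
inject₁∈∷ʳ⁺ here        = here
inject₁∈∷ʳ⁺ (there j∈p) = there (inject₁∈∷ʳ⁺ j∈p)

inject₁∈∷ʳ⁻ : ∀ {n} {p : Subset n} {b} {j : Fin n} → inject₁ j ∈ p ∷ʳ b → j ∈ p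
inject₁∈∷ʳ⁻ {p = _ ∷ _} {j = zero}  here         = here
inject₁∈∷ʳ⁻ {p = _ ∷ _} {j = suc j} (there j∈p) = there (inject₁∈∷ʳ⁻ j∈p)

fromℕ∈∷ʳ⁻ : ∀ {n} {p : Subset n} {b} → fromℕ n ∈ p ∷ʳ b → b ≡ inside
fromℕ∈∷ʳ⁻ {p = []}    here        = refl
fromℕ∈∷ʳ⁻ {p = _ ∷ _} (there e∈p) = fromℕ∈∷ʳ⁻ e∈p

fromℕ∉∷ʳoutside : ∀ {n} {p : Subset n} → fromℕ n ∉ p ∷ʳ outside
fromℕ∉∷ʳoutside e∈p with fromℕ∈∷ʳ⁻ e∈p
... | ()

fromℕ∈∷ʳinside : ∀ {n} (p : Subset n) → fromℕ n ∈ p ∷ʳ inside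
fromℕ∈∷ʳinside []      = here
fromℕ∈∷ʳinside (_ ∷ p) = there (fromℕ∈∷ʳinside p)

∷ʳ-⊆⁻ : ∀ {n} {p q : Subset n} {a b} → p ∷ʳ a ⊆ q ∷ʳ b → p ⊆ q
∷ʳ-⊆⁻ sub = inject₁∈∷ʳ⁻ ∘ sub ∘ inject₁∈∷ʳ⁺

∷ʳoutside-⊆⁺ : ∀ {n} {p : Subset n} {q : Subset (suc n)} →
               (∀ {j} → j ∈ p → inject₁ j ∈ q) → p ∷ʳ outside ⊆ q
∷ʳoutside-⊆⁺ p⊆q {x} x∈ with view x
... | ‵fromℕ     = contradiction x∈ fromℕ∉∷ʳoutside
... | ‵inject₁ j = p⊆q (inject₁∈∷ʳ⁻ x∈)

∷ʳ-∪ : ∀ {n} (p q : Subset n) a b → (p ∷ʳ a) ∪ (q ∷ʳ b) ≡ (p ∪ q) ∷ʳ (a ∨ b)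
∷ʳ-∪ []      []      a b = refl
∷ʳ-∪ (x ∷ p) (y ∷ q) a b = cong ((x ∨ y) ∷_) (∷ʳ-∪ p q a b)

∅≡∅∷ʳoutside : ∀ n → ∅ {suc n} ≡ ∅ ∷ʳ outside
∅≡∅∷ʳoutside zero    = refl
∅≡∅∷ʳoutside (suc n) = cong (outside ∷_) (∅≡∅∷ʳoutside n)

⊤≡⊤∷ʳinside : ∀ n → ⊤ {suc n} ≡ ⊤ ∷ʳ inside
⊤≡⊤∷ʳinside zero    = refl
⊤≡⊤∷ʳinside (suc n) = cong (inside ∷_) (⊤≡⊤∷ʳinside n)

⁅inject₁⁆≡⁅⁆∷ʳoutside : ∀ {n} (j : Fin n) → ⁅ inject₁ j ⁆ ≡ ⁅ j ⁆ ∷ʳ outside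
⁅inject₁⁆≡⁅⁆∷ʳoutside {suc n} zero    = cong (inside ∷_) (∅≡∅∷ʳoutside n)
⁅inject₁⁆≡⁅⁆∷ʳoutside         (suc j) = cong (outside ∷_) (⁅inject₁⁆≡⁅⁆∷ʳoutside j)

⁅fromℕ⁆≡∅∷ʳinside : ∀ n → ⁅ fromℕ n ⁆ ≡ ∅ ∷ʳ inside
⁅fromℕ⁆≡∅∷ʳinside zero    = refl
⁅fromℕ⁆≡∅∷ʳinside (suc n) = cong (outside ∷_) (⁅fromℕ⁆≡∅∷ʳinside n)

∷ʳ-∪⁅inject₁⁆ : ∀ {n} (p : Subset n) b (j : Fin n) → (p ∷ʳ b) ∪ ⁅ inject₁ j ⁆ ≡ (p ∪ ⁅ j ⁆) ∷ʳ b
∷ʳ-∪⁅inject₁⁆ p b j = begin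
  (p ∷ʳ b) ∪ ⁅ inject₁ j ⁆        ≡⟨ cong ((p ∷ʳ b) ∪_) (⁅inject₁⁆≡⁅⁆∷ʳoutside j) ⟩
  (p ∷ʳ b) ∪ (⁅ j ⁆ ∷ʳ outside)  ≡⟨ ∷ʳ-∪ p ⁅ j ⁆ b outside ⟩
  (p ∪ ⁅ j ⁆) ∷ʳ (b ∨ outside)    ≡⟨ cong ((p ∪ ⁅ j ⁆) ∷ʳ_) (∨-identityʳ b) ⟩
  (p ∪ ⁅ j ⁆) ∷ʳ b                ∎
  where open ≡-Reasoning

∷ʳ-∪⁅fromℕ⁆ : ∀ {n} (p : Subset n) b → (p ∷ʳ b) ∪ ⁅ fromℕ n ⁆ ≡ p ∷ʳ inside
∷ʳ-∪⁅fromℕ⁆ {n} p b = begin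
  (p ∷ʳ b) ∪ ⁅ fromℕ n ⁆      ≡⟨ cong ((p ∷ʳ b) ∪_) (⁅fromℕ⁆≡∅∷ʳinside n) ⟩
  (p ∷ʳ b) ∪ (∅ ∷ʳ inside)  ≡⟨ ∷ʳ-∪ p ∅ b inside ⟩
  (p ∪ ∅) ∷ʳ (b ∨ inside)    ≡⟨ cong₂ _∷ʳ_ (∪-identityʳ p) (∨-zeroʳ b) ⟩
  p ∷ʳ inside                 ∎
  where open ≡-Reasoning

-- Bases, flats and closure

module _ {n : ℕ} (M : Matroid n) where

  -- J ⊆ cl(I) when I is independent.
  Spans : Subset n → Subset n → Set
  Spans I J = ∀ y → y ∈ J → y ∉ I → ¬ Indep M (I ∪ ⁅ y ⁆)

  record IsBasis (A B : Subset n) : Set where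
    field
      basis⊆  : B ⊆ A
      indep   : Indep M B
      maximal : Spans B A

  open IsBasis public

  basis-largest : ∀ {A B I} → IsBasis A B → I ⊆ A → Indep M I → ∣ I ∣ ≤ ∣ B ∣
  basis-largest {A} {B} {I} basisB I⊆A indI with ∣ I ∣ ≤? ∣ B ∣
  ... | yes ∣I∣≤∣B∣ = ∣I∣≤∣B∣
  ... | no  ∣I∣≰∣B∣ with augment M (indep basisB) indI (≰⇒> ∣I∣≰∣B∣)
  ...   | y , y∈I , y∉B , indBy = contradiction indBy (maximal basisB y (I⊆A y∈I) y∉B)

  isRankOf-basis : ∀ {A B} → IsBasis A B → IsRankOf M A ∣ B ∣
  isRankOf-basis basisB = (_ , basis⊆ basisB , indep basisB , refl) , λ _ → basis-largest basisB

  isRankOf-unique : ∀ {A k k'} → IsRankOf M A k → IsRankOf M A k' → k ≡ k'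
  isRankOf-unique ((I , I⊆A , indI , refl) , maxI) ((J , J⊆A , indJ , refl) , maxJ) =
    ≤-antisym (maxJ I I⊆A indI) (maxI J J⊆A indJ)

  basis⇒isFlat : ∀ {F B} → IsBasis F B → (∀ x → x ∉ F → Indep M (B ∪ ⁅ x ⁆)) → IsFlat M F
  basis⇒isFlat {F} {B} basisB extend x x∉F k k' ((I , I⊆F , indI , refl) , _) (_ , maxFx) = begin-strict
    ∣ I ∣                ≤⟨ basis-largest basisB I⊆F indI ⟩
    ∣ B ∣                <⟨ n<1+n ∣ B ∣ ⟩
    suc ∣ B ∣            ≡⟨ ∣p∪⁅x⁆∣≡1+∣p∣ B (x∉F ∘ basis⊆ basisB) ⟨
    ∣ B ∪ ⁅ x ⁆ ∣        ≤⟨ maxFx (B ∪ ⁅ x ⁆) (∪⁅⁆-monoˡ x (basis⊆ basisB)) (extend x x∉F) ⟩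
    k'                   ∎
    where open ≤-Reasoning

  -- S ⊈ cl(I) when I is independent.
  Extensible : Subset n → Subset n → Set
  Extensible S I = ∃ λ s → s ∈ S × s ∉ I × Indep M (I ∪ ⁅ s ⁆)

  extensible-antitone : ∀ {S I J} → I ⊆ J → Extensible S J → Extensible S I
  extensible-antitone I⊆J (s , s∈S , s∉J , indJs) =
    s , s∈S , s∉J ∘ I⊆J , indep-⊆ M (∪⁅⁆-monoˡ s I⊆J) indJs

  spans⇒extensible : ∀ {S I J} → Indep M I → Spans I J → ∣ I ∣ ≤ ∣ J ∣ →
                     Extensible S J → Extensible S I
  spans⇒extensible {I = I} {J} indI spans ∣I∣≤∣J∣ (s , s∈S , s∉J , indJs)
    with augment M indI indJs (subst (∣ I ∣ <_) (sym (∣p∪⁅x⁆∣≡1+∣p∣ J s∉J)) (s≤s ∣I∣≤∣J∣))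
  ... | y , y∈Js , y∉I , indIy with x∈p∪⁅y⁆⁻ J y∈Js
  ...   | inj₁ y∈J = contradiction indIy (spans y y∈J y∉I)
  ...   | inj₂ refl = s , s∈S , y∉I , indIy

  -- Augmenting I ∪ {f} from I ∪ {x} ∪ {y} adds x or y, and f still extends the result.
  extensible-∪⁅⁆ : ∀ {S I x y} → Extensible S I → x ∉ I → y ∉ I ∪ ⁅ x ⁆ →
                   Indep M ((I ∪ ⁅ x ⁆) ∪ ⁅ y ⁆) →
                   Extensible S (I ∪ ⁅ x ⁆) ⊎ Extensible S (I ∪ ⁅ y ⁆)
  extensible-∪⁅⁆ {S} {I} {x} {y} (f , f∈S , f∉I , indIf) x∉I y∉Ix indIxy
    with augment M indIf indIxy size
    where
    size : ∣ I ∪ ⁅ f ⁆ ∣ < ∣ (I ∪ ⁅ x ⁆) ∪ ⁅ y ⁆ ∣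
    size rewrite ∣p∪⁅x⁆∣≡1+∣p∣ I f∉I | ∣p∪⁅x⁆∣≡1+∣p∣ (I ∪ ⁅ x ⁆) y∉Ix | ∣p∪⁅x⁆∣≡1+∣p∣ I x∉I =
      ≤-refl
  ... | z , z∈Ixy , z∉If , indIfz = cases (x∈p∪⁅y⁆⁻ (I ∪ ⁅ x ⁆) z∈Ixy)
    where
    extensibleIz : Extensible S (I ∪ ⁅ z ⁆)
    extensibleIz = f , f∈S , x∉p∪⁅y⁆ f∉I (λ { refl → z∉If (x∈p∪⁅x⁆ I f) }) ,
                   subst (Indep M) (∪⁅⁆-swap I f z) indIfz
    cases : z ∈ I ∪ ⁅ x ⁆ ⊎ z ≡ y → Extensible S (I ∪ ⁅ x ⁆) ⊎ Extensible S (I ∪ ⁅ y ⁆)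
    cases (inj₂ refl) = inj₂ extensibleIz
    cases (inj₁ z∈Ix) with x∈p∪⁅y⁆⁻ I z∈Ix
    ... | inj₁ z∈I  = contradiction (p⊆p∪q ⁅ f ⁆ z∈I) z∉If
    ... | inj₂ refl = inj₁ extensibleIz

  module _ (indep? : Decidable (Indep M)) where

    extendToBasis : ∀ {A I} → I ⊆ A → Indep M I → ∃ λ B → I ⊆ B × IsBasis A B
    extendToBasis I⊆A indI = grow n I⊆A indI (m≤m+n n _)
      where
      grow : ∀ fuel {A I} → I ⊆ A → Indep M I → n ≤ fuel + ∣ I ∣ → ∃ λ B → I ⊆ B × IsBasis A B
      grow fuel {A} {I} I⊆A indI bound
        with any? (λ y → y ∈? A ×-dec ¬? (y ∈? I) ×-dec indep? (I ∪ ⁅ y ⁆))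
      ... | no stuck = I , id , record
        { basis⊆ = I⊆A ; indep = indI ; maximal = λ y y∈A y∉I indIy → stuck (y , y∈A , y∉I , indIy) }
      ... | yes (y , y∈A , y∉I , indIy) with fuel
      ...   | zero =
        contradiction (subst (_≤ n) (∣p∪⁅x⁆∣≡1+∣p∣ I y∉I) (∣p∣≤n (I ∪ ⁅ y ⁆))) (<⇒≱ (s≤s bound))
      ...   | suc fuel'
        with grow fuel' (p∪⁅x⁆⊆q I⊆A y∈A) indIy
               (subst (n ≤_) (sym (trans (cong (fuel' +_) (∣p∪⁅x⁆∣≡1+∣p∣ I y∉I)) (+-suc fuel' _))) bound)
      ...     | B , Iy⊆B , basisB = B , Iy⊆B ∘ p⊆p∪q ⁅ y ⁆ , basisB

    basis : ∀ A → ∃ (IsBasis A)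
    basis A with extendToBasis {A} {∅} ⊥⊆ (indep-∅ M)
    ... | B , _ , basisB = B , basisB

    isFlat⇒indep-∪⁅⁆ : ∀ {F I x} → IsFlat M F → I ⊆ F → Indep M I → x ∉ F → Indep M (I ∪ ⁅ x ⁆)
    isFlat⇒indep-∪⁅⁆ {F} {I} {x} flat I⊆F indI x∉F with extendToBasis I⊆F indI
    ... | B , I⊆B , basisB with extendToBasis (p⊆p∪q ⁅ x ⁆ ∘ basis⊆ basisB) (indep basisB)
    ... | B' , B⊆B' , basisB'
      with augment M (indep basisB) (indep basisB')
             (flat x x∉F _ _ (isRankOf-basis basisB) (isRankOf-basis basisB'))
    ... | y , y∈B' , y∉B , indBy with x∈p∪⁅y⁆⁻ F (basis⊆ basisB' y∈B')
    ...   | inj₁ y∈F = contradiction indBy (maximal basisB y y∈F y∉B)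
    ...   | inj₂ refl = indep-⊆ M (∪⁅⁆-monoˡ y I⊆B) indBy

    isFlat? : Decidable (IsFlat M)
    isFlat? F with basis F
    ... | B , basisB = map′ from to (all? (λ x → x ∈? F ⊎-dec indep? (B ∪ ⁅ x ⁆)))
      where
      from : (∀ x → x ∈ F ⊎ Indep M (B ∪ ⁅ x ⁆)) → IsFlat M F
      from inFOrIndep =
        basis⇒isFlat basisB λ x x∉F → [ (λ x∈F → contradiction x∈F x∉F) , id ]′ (inFOrIndep x)
      to : IsFlat M F → ∀ x → x ∈ F ⊎ Indep M (B ∪ ⁅ x ⁆)
      to flat x with x ∈? F
      ... | yes x∈F = inj₁ x∈F
      ... | no  x∉F = inj₂ (isFlat⇒indep-∪⁅⁆ flat (basis⊆ basisB) (indep basisB) x∉F)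

    isRank? : ∀ k → Dec (IsRank M k)
    isRank? k with basis ⊤
    ... | B , basisB = map′ (λ { refl → isRankOf-basis basisB })
                            (λ rank → isRankOf-unique rank (isRankOf-basis basisB)) (k ≟ ∣ B ∣)

    extensible? : ∀ S → Decidable (Extensible S)
    extensible? S I = any? λ s → s ∈? S ×-dec ¬? (s ∈? I) ×-dec indep? (I ∪ ⁅ s ⁆)

    extensible-augment : ∀ {S p q} → Indep M p → Extensible S p → Indep M q → ∣ p ∣ < ∣ q ∣ →
                         suc ∣ p ∣ < ∣ q ∣ ⊎ Extensible S q →
                         ∃ λ x → x ∈ q × x ∉ p × Indep M (p ∪ ⁅ x ⁆) × Extensible S (p ∪ ⁅ x ⁆)
    extensible-augment {S} {p} {q} indp extp indq ∣p∣<∣q∣ largeOrExtq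
      with any? (λ x → x ∈? q ×-dec ¬? (x ∈? p) ×-dec indep? (p ∪ ⁅ x ⁆) ×-dec extensible? S (p ∪ ⁅ x ⁆))
    ... | yes found = found
    ... | no none   = refute (augment M indp indq ∣p∣<∣q∣)
      where
      notExtensible : ∀ {x} → x ∈ q → x ∉ p → Indep M (p ∪ ⁅ x ⁆) → ¬ Extensible S (p ∪ ⁅ x ⁆)
      notExtensible x∈q x∉p indpx extpx = none (_ , x∈q , x∉p , indpx , extpx)

      refute : (∃ λ x → x ∈ q × x ∉ p × Indep M (p ∪ ⁅ x ⁆)) →
               ∃ λ x → x ∈ q × x ∉ p × Indep M (p ∪ ⁅ x ⁆) × Extensible S (p ∪ ⁅ x ⁆)
      refute (x , x∈q , x∉p , indpx) =
        contradiction (spans⇒extensible indpx spans (subst (_≤ ∣ q ∣) (sym ∣px∣≡1+∣p∣) ∣p∣<∣q∣) extq)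
                      (notExtensible x∈q x∉p indpx)
        where
        ∣px∣≡1+∣p∣ : ∣ p ∪ ⁅ x ⁆ ∣ ≡ suc ∣ p ∣
        ∣px∣≡1+∣p∣ = ∣p∪⁅x⁆∣≡1+∣p∣ p x∉p

        spans : Spans (p ∪ ⁅ x ⁆) q
        spans y y∈q y∉px indpxy =
          [ notExtensible x∈q x∉p indpx , notExtensible y∈q (y∉px ∘ p⊆p∪q ⁅ x ⁆) indpy ]′
            (extensible-∪⁅⁆ extp x∉p y∉px indpxy)
          where indpy = indep-⊆ M (∪⁅⁆-monoˡ y (p⊆p∪q ⁅ x ⁆)) indpxy

        notLarge : ¬ suc ∣ p ∣ < ∣ q ∣
        notLarge large with augment M indpx indq (subst (_< ∣ q ∣) (sym ∣px∣≡1+∣p∣) large)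
        ... | y , y∈q , y∉px , indpxy = spans y y∈q y∉px indpxy

        extq : Extensible S q
        extq = [ (λ large → contradiction large notLarge) , id ]′ largeOrExtq

-- Existence of minimum ranks

isRankOf-≐ : ∀ {n} {M N : Matroid n} {A k} → Indep M ≐ Indep N → IsRankOf M A k → IsRankOf N A k
isRankOf-≐ (M⊆N , N⊆M) ((I , I⊆A , indI , ∣I∣≡k) , maxI) =
  (I , I⊆A , M⊆N indI , ∣I∣≡k) , λ J J⊆A indJ → maxI J J⊆A (N⊆M indJ)

inR-≐ : ∀ {m n} {X : Pattern m n} {M N : Matroid n} → Indep M ≐ Indep N → InR X M → InR X N
inR-≐ {M = M} {N} (M⊆N , N⊆M) inR i Z zeroSetZ x x∉Z k k' rank rank' =
  inR i Z zeroSetZ x x∉Z k k' (isRankOf-≐ {M = N} {M} (N⊆M , M⊆N) rank)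
                              (isRankOf-≐ {M = N} {M} (N⊆M , M⊆N) rank')

¬¬-decidable : ∀ {n} (P : Subset n → Set) → ¬ ¬ Decidable P
¬¬-decidable {zero} P noDecision = ¬¬-excluded-middle λ P[]? → noDecision λ { [] → P[]? }
¬¬-decidable {suc n} P noDecision =
  ¬¬-decidable (P ∘ (outside ∷_)) λ P₀? →
  ¬¬-decidable (P ∘ (inside ∷_)) λ P₁? →
  noDecision λ { (outside ∷ I) → P₀? I ; (inside ∷ I) → P₁? I }

least-satisfying : ∀ {P : ℕ → Set} → Decidable P → ∀ b → P b → ∃ λ k → P k × (∀ j → P j → k ≤ j)
least-satisfying P? b Pb with P? 0
... | yes P0 = 0 , P0 , λ _ _ → z≤n
least-satisfying P? zero    P0 | no ¬P0 = contradiction P0 ¬P0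
least-satisfying P? (suc b) Pb | no ¬P0 with least-satisfying (P? ∘ suc) b Pb
... | k , Pk , least = suc k , Pk , λ { zero P0 → contradiction P0 ¬P0 ; (suc j) Pj → s≤s (least j Pj) }

RankLowerBound : ∀ {m n} → Pattern m n → ℕ → Set₁
RankLowerBound {n = n} X k = ∀ (M : Matroid n) k' → InR X M → IsRank M k' → k ≤ k'

-- k ≤ k' is decidable, hence ¬¬-stable, and every predicate on subsets of Fin n is ¬¬-decidable.
rankLowerBound-decidable : ∀ {m n} (X : Pattern m n) k →
  (∀ M → Decidable (Indep M) → ∀ k' → InR X M → IsRank M k' → k ≤ k') → RankLowerBound X k
rankLowerBound-decidable X k bound M k' inR rank =
  decidable-stable (k ≤? k') (¬¬-map (λ indep? → bound M indep? k' inR rank) (¬¬-decidable (Indep M)))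

-- A Boolean function on subsets of Fin n, stored as its table of values.
Table : ℕ → Set
Table zero    = Bool
Table (suc n) = Table n × Table n

_!_ : ∀ {n} → Table n → Subset n → Bool
_!_ {zero}  b         []            = b
_!_ {suc n} (t₀ , t₁) (outside ∷ I) = t₀ ! I
_!_ {suc n} (t₀ , t₁) (inside ∷ I)  = t₁ ! I

toTable : ∀ {n} {P : Subset n → Set} → Decidable P → Table n
toTable {zero}  P? = isYes (P? [])
toTable {suc n} P? = toTable (P? ∘ (outside ∷_)) , toTable (P? ∘ (inside ∷_))

toTable-≐ : ∀ {n} {P : Subset n → Set} (P? : Decidable P) → (T ∘ (toTable P? !_)) ≐ P
toTable-≐ {zero} P? = (λ { {[]} → toWitness }) , (λ { {[]} → fromWitness })
toTable-≐ {suc n} P? = (λ { {outside ∷ I} → proj₁ (toTable-≐ (P? ∘ (outside ∷_)))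
                         ; {inside ∷ I}  → proj₁ (toTable-≐ (P? ∘ (inside ∷_))) })
                     , (λ { {outside ∷ I} → proj₂ (toTable-≐ (P? ∘ (outside ∷_)))
                         ; {inside ∷ I}  → proj₂ (toTable-≐ (P? ∘ (inside ∷_))) })

anyTable? : ∀ {n} {R : Table n → Set} → (∀ t → Dec (R t)) → Dec (∃ R)
anyTable? {zero} R? = map′ [ (true ,_) , (false ,_) ]′ (λ { (true , r) → inj₁ r ; (false , r) → inj₂ r })
                           (R? true ⊎-dec R? false)
anyTable? {suc n} R? = map′ (λ (t₀ , t₁ , r) → (t₀ , t₁) , r) (λ ((t₀ , t₁) , r) → t₀ , t₁ , r)
                            (anyTable? λ t₀ → anyTable? λ t₁ → R? (t₀ , t₁))

allSubset? : ∀ {n} {P : Subset n → Set} → Decidable P → Dec (∀ I → P I)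
allSubset? P? = map′ (λ noCounterexample I → decidable-stable (P? I) (noCounterexample ∘ (I ,_)))
                     (λ all (I , ¬PI) → ¬PI (all I))
                     (¬? (anySubset? (¬? ∘ P?)))

module _ {n : ℕ} where

  Hereditary : (Subset n → Set) → Set
  Hereditary P = ∀ I J → I ⊆ J → P J → P I

  Exchange : (Subset n → Set) → Set
  Exchange P = ∀ I J → P I → P J → ∣ I ∣ < ∣ J ∣ → ∃ λ e → e ∈ J × e ∉ I × P (I ∪ ⁅ e ⁆)

  MatroidAxioms : (Subset n → Set) → Set
  MatroidAxioms P = P ∅ × Hereditary P × Exchange P

  toMatroid : ∀ {P} → MatroidAxioms P → Matroid n
  toMatroid {P} (P∅ , hereditary , exchange) = record
    { Indep   = P
    ; indep-∅ = P∅
    ; indep-⊆ = λ {I} {J} → hereditary I J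
    ; augment = λ {I} {J} → exchange I J
    }

  matroidAxioms? : ∀ {P} → Decidable P → Dec (MatroidAxioms P)
  matroidAxioms? P? =
    P? ∅ ×-dec
    allSubset? (λ I → allSubset? λ J → I ⊆? J →-dec P? J →-dec P? I) ×-dec
    allSubset? (λ I → allSubset? λ J → P? I →-dec P? J →-dec suc ∣ I ∣ ≤? ∣ J ∣ →-dec
                  any? λ e → e ∈? J ×-dec ¬? (e ∈? I) ×-dec P? (I ∪ ⁅ e ⁆))

  matroidAxioms-≐ : ∀ {P} (M : Matroid n) → P ≐ Indep M → MatroidAxioms P
  matroidAxioms-≐ M (P⊆M , M⊆P) =
    M⊆P (indep-∅ M) ,
    (λ I J I⊆J PJ → M⊆P (indep-⊆ M I⊆J (P⊆M PJ))) ,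
    λ I J PI PJ ∣I∣<∣J∣ → let e , e∈J , e∉I , indIe = augment M (P⊆M PI) (P⊆M PJ) ∣I∣<∣J∣
                          in e , e∈J , e∉I , M⊆P indIe

  freeMatroid : Matroid n
  freeMatroid = record
    { Indep   = λ _ → Unit
    ; indep-∅ = tt
    ; indep-⊆ = λ _ _ → tt
    ; augment = λ {I} {J} _ _ ∣I∣<∣J∣ →
        let e , e∈J , e∉I = p⊈q⇒∃∈p∉q (λ J⊆I → <⇒≱ ∣I∣<∣J∣ (p⊆q⇒∣p∣≤∣q∣ J⊆I)) in e , e∈J , e∉I , tt
    }

  freeMatroid-isFlat : ∀ F → IsFlat freeMatroid F
  freeMatroid-isFlat F = basis⇒isFlat freeMatroid basisF (λ _ _ → tt)
    where
    basisF : IsBasis freeMatroid F F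
    basisF = record { basis⊆ = id ; indep = tt ; maximal = λ y y∈F y∉F _ → y∉F y∈F }

  freeMatroid-isRank : IsRank freeMatroid n
  freeMatroid-isRank = subst (IsRank freeMatroid) (∣⊤∣≡n n) (isRankOf-basis freeMatroid basis⊤)
    where
    basis⊤ : IsBasis freeMatroid ⊤ ⊤
    basis⊤ = record { basis⊆ = id ; indep = tt ; maximal = λ y _ y∉⊤ _ → y∉⊤ ∈⊤ }

isZero : Entry → Bool
isZero zero = true
isZero star = false

zeroSet : ∀ {n} → (Fin n → Entry) → Subset n
zeroSet row = tabulate (isZero ∘ row)

isZero⇒≡zero : ∀ {e} → isZero e ≡ true → e ≡ zero
isZero⇒≡zero {zero} _  = refl
isZero⇒≡zero {star} ()

isRowZeroSet-zeroSet : ∀ {m n} (X : Pattern m n) i → IsRowZeroSet X i (zeroSet (X i))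
isRowZeroSet-zeroSet X i j =
  (λ j∈Z → isZero⇒≡zero (trans (sym (lookup∘tabulate (isZero ∘ X i) j)) ([]=⇒lookup j∈Z))) ,
  (λ Xij≡zero → lookup⇒[]= j _ (trans (lookup∘tabulate (isZero ∘ X i) j) (cong isZero Xij≡zero)))

isRowZeroSet-unique : ∀ {m n} {X : Pattern m n} {i Z Z'} →
                      IsRowZeroSet X i Z → IsRowZeroSet X i Z' → Z ≡ Z'
isRowZeroSet-unique zerosZ zerosZ' =
  ⊆-antisym (λ {j} → proj₂ (zerosZ' j) ∘ proj₁ (zerosZ j)) (λ {j} → proj₂ (zerosZ j) ∘ proj₁ (zerosZ' j))

inR? : ∀ {m n} (X : Pattern m n) (M : Matroid n) → Decidable (Indep M) → Dec (InR X M)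
inR? X M indep? = map′ from to (all? λ i → isFlat? M indep? (zeroSet (X i)))
  where
  from : (∀ i → IsFlat M (zeroSet (X i))) → InR X M
  from flat i Z zerosZ =
    subst (IsFlat M) (isRowZeroSet-unique {X = X} (isRowZeroSet-zeroSet X i) zerosZ) (flat i)
  to : InR X M → ∀ i → IsFlat M (zeroSet (X i))
  to inR i = inR i _ (isRowZeroSet-zeroSet X i)

module _ {m n : ℕ} (X : Pattern m n) where

  Attains : ℕ → Set₁
  Attains k = Σ (Matroid n) λ M → Decidable (Indep M) × InR X M × IsRank M k

  TableAttainsWith : Table n → ℕ → Set
  TableAttainsWith t k =
    Σ (MatroidAxioms (T ∘ (t !_))) λ axioms → InR X (toMatroid axioms) × IsRank (toMatroid axioms) k

  TableAttains : ℕ → Set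
  TableAttains k = ∃ λ t → TableAttainsWith t k

  -- InR and IsRank only see the field Indep = T ∘ (t !_), so any proof of the axioms will do.
  tableAttains? : Decidable TableAttains
  tableAttains? k = anyTable? λ t → attains? t (matroidAxioms? (T? ∘ (t !_)))
    where
    attains? : ∀ t → Dec (MatroidAxioms (T ∘ (t !_))) → Dec (TableAttainsWith t k)
    attains? t (no ¬axioms) = no (¬axioms ∘ proj₁)
    attains? t (yes axioms) = map′ (axioms ,_) proj₂
      (inR? X (toMatroid axioms) (T? ∘ (t !_)) ×-dec isRank? (toMatroid axioms) (T? ∘ (t !_)) k)

  attains⇒tableAttains : ∀ {k} → Attains k → TableAttains k
  attains⇒tableAttains (M , indep? , inR , rank) =
    toTable indep? , axioms ,
    inR-≐ {X = X} {M} {toMatroid axioms} M≐ inR , isRankOf-≐ {M = M} {toMatroid axioms} M≐ rank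
    where
    axioms = matroidAxioms-≐ M (toTable-≐ indep?)
    M≐ : Indep M ≐ Indep (toMatroid axioms)
    M≐ = proj₂ (toTable-≐ indep?) , proj₁ (toTable-≐ indep?)

  tableAttains⇒attains : ∀ {k} → TableAttains k → Attains k
  tableAttains⇒attains (t , axioms , inR , rank) = toMatroid axioms , T? ∘ (t !_) , inR , rank

  minimumRank : ∃ λ k → Attains k × RankLowerBound X k
  minimumRank =
    let k , attainsK , least = least-satisfying tableAttains? n
                                 (attains⇒tableAttains (freeMatroid , (λ _ → yes tt) ,
                                    (λ i Z _ → freeMatroid-isFlat Z) , freeMatroid-isRank))
    in k , tableAttains⇒attains attainsK ,
       rankLowerBound-decidable X k λ M indep? k' inR rank →
         least k' (attains⇒tableAttains (M , indep? , inR , rank))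

-- Principal extension and deletion

module PrincipalExtension {n : ℕ} (M : Matroid n) (indep? : Decidable (Indep M)) (S : Subset n) where

  -- IndepWith b p is independence of p ∷ʳ b.
  IndepWith : Bool → Subset n → Set
  IndepWith outside p = Indep M p
  IndepWith inside  p = Indep M p × Extensible M S p

  Indep⁺ : Subset (suc n) → Set
  Indep⁺ I = IndepWith (last I) (init I)

  Indep⁺-∷ʳ : ∀ p b → Indep⁺ (p ∷ʳ b) ≡ IndepWith b p
  Indep⁺-∷ʳ p b = cong₂ IndepWith (last-∷ʳ b p) (init-∷ʳ b p)

  Indep⁺-∷ʳ⁺ : ∀ {p b} → IndepWith b p → Indep⁺ (p ∷ʳ b)
  Indep⁺-∷ʳ⁺ {p} {b} = subst id (sym (Indep⁺-∷ʳ p b))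

  Indep⁺-∷ʳ⁻ : ∀ {p b} → Indep⁺ (p ∷ʳ b) → IndepWith b p
  Indep⁺-∷ʳ⁻ {p} {b} = subst id (Indep⁺-∷ʳ p b)

  indepWith-⊆ : ∀ {p q} a b → p ⊆ q → (a ≡ inside → b ≡ inside) → IndepWith b q → IndepWith a p
  indepWith-⊆ outside outside p⊆q _ indq = indep-⊆ M p⊆q indq
  indepWith-⊆ outside inside  p⊆q _ indq = indep-⊆ M p⊆q (proj₁ indq)
  indepWith-⊆ inside  inside  p⊆q _ (indq , extq) = indep-⊆ M p⊆q indq , extensible-antitone M p⊆q extq
  indepWith-⊆ inside  outside p⊆q a⇒b _ with a⇒b refl
  ... | ()

  indepWith-augment : ∀ {p q} a b → IndepWith a p → IndepWith b q → ∣ p ∷ʳ a ∣ < ∣ q ∷ʳ b ∣ →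
    (∃ λ x → x ∈ q × x ∉ p × IndepWith a (p ∪ ⁅ x ⁆)) ⊎ (a ≡ outside × b ≡ inside × IndepWith inside p)
  indepWith-augment {p} {q} outside outside indp indq size
    rewrite ∣p∷ʳoutside∣ p | ∣p∷ʳoutside∣ q = inj₁ (augment M indp indq size)
  indepWith-augment {p} {q} outside inside indp (indq , s , s∈S , s∉q , indqs) size
    rewrite ∣p∷ʳoutside∣ p | ∣p∷ʳinside∣ q
    with augment M indp indqs (subst (∣ p ∣ <_) (sym (∣p∪⁅x⁆∣≡1+∣p∣ q s∉q)) size)
  ... | y , y∈qs , y∉p , indpy with x∈p∪⁅y⁆⁻ q y∈qs
  ...   | inj₁ y∈q  = inj₁ (y , y∈q , y∉p , indpy)
  ...   | inj₂ refl = inj₂ (refl , refl , indp , y , s∈S , y∉p , indpy)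
  indepWith-augment {p} {q} inside outside (indp , extp) indq size
    rewrite ∣p∷ʳinside∣ p | ∣p∷ʳoutside∣ q =
    inj₁ (extensible-augment M indep? indp extp indq (<-trans (n<1+n _) size) (inj₁ size))
  indepWith-augment {p} {q} inside inside (indp , extp) (indq , extq) size
    rewrite ∣p∷ʳinside∣ p | ∣p∷ʳinside∣ q =
    inj₁ (extensible-augment M indep? indp extp indq (s<s⁻¹ size) (inj₂ extq))

  extension : Matroid (suc n)
  extension = record
    { Indep   = Indep⁺
    ; indep-∅ = subst Indep⁺ (sym (∅≡∅∷ʳoutside n)) (Indep⁺-∷ʳ⁺ (indep-∅ M))
    ; indep-⊆ = indep⁺-⊆
    ; augment = augment⁺
    }
    where
    -- Matching on initLast I also rewrites Indep⁺ I to IndepWith a p.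
    indep⁺-⊆ : ∀ {I J} → I ⊆ J → Indep⁺ J → Indep⁺ I
    indep⁺-⊆ {I} {J} I⊆J indJ with initLast I | initLast J
    ... | p , a , refl | q , b , refl =
      indepWith-⊆ a b (∷ʳ-⊆⁻ I⊆J) (λ { refl → fromℕ∈∷ʳ⁻ (I⊆J (fromℕ∈∷ʳinside p)) }) indJ

    augment⁺ : ∀ {I J} → Indep⁺ I → Indep⁺ J → ∣ I ∣ < ∣ J ∣ →
               ∃ λ e → e ∈ J × e ∉ I × Indep⁺ (I ∪ ⁅ e ⁆)
    augment⁺ {I} {J} indI indJ ∣I∣<∣J∣ with initLast I | initLast J
    ... | p , a , refl | q , b , refl
      with indepWith-augment a b indI indJ ∣I∣<∣J∣
    ...   | inj₁ (x , x∈q , x∉p , indpx) =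
      inject₁ x , inject₁∈∷ʳ⁺ x∈q , x∉p ∘ inject₁∈∷ʳ⁻ ,
      subst Indep⁺ (sym (∷ʳ-∪⁅inject₁⁆ p a x)) (Indep⁺-∷ʳ⁺ indpx)
    ...   | inj₂ (refl , refl , indp⁺) =
      fromℕ n , fromℕ∈∷ʳinside q , fromℕ∉∷ʳoutside ,
      subst Indep⁺ (sym (∷ʳ-∪⁅fromℕ⁆ p outside)) (Indep⁺-∷ʳ⁺ indp⁺)

  liftBasis : ∀ {A B b} → IsBasis M A B → (b ≡ inside → ¬ Extensible M S B) →
              IsBasis extension (A ∷ʳ b) (B ∷ʳ outside)
  liftBasis {A} {B} {b} basisB notExtensible = record
    { basis⊆  = ∷ʳoutside-⊆⁺ (inject₁∈∷ʳ⁺ ∘ basis⊆ basisB)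
    ; indep   = Indep⁺-∷ʳ⁺ (indep basisB)
    ; maximal = maximal⁺
    }
    where
    maximal⁺ : Spans extension (B ∷ʳ outside) (A ∷ʳ b)
    maximal⁺ y y∈A y∉B indBy with view y
    ... | ‵fromℕ = notExtensible (fromℕ∈∷ʳ⁻ y∈A)
                     (proj₂ (Indep⁺-∷ʳ⁻ (subst Indep⁺ (∷ʳ-∪⁅fromℕ⁆ B outside) indBy)))
    ... | ‵inject₁ j = maximal basisB j (inject₁∈∷ʳ⁻ y∈A) (y∉B ∘ inject₁∈∷ʳ⁺)
                         (Indep⁺-∷ʳ⁻ (subst Indep⁺ (∷ʳ-∪⁅inject₁⁆ B outside j) indBy))

  extension-isRank : ∀ {k} → IsRank M k → IsRank extension k
  extension-isRank rank with basis M indep? ⊤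
  ... | B , basis⊤ =
    subst₂ (IsRankOf extension) (sym (⊤≡⊤∷ʳinside n))
      (trans (∣p∷ʳoutside∣ B) (isRankOf-unique M (isRankOf-basis M basis⊤) rank))
      (isRankOf-basis extension
         (liftBasis basis⊤ λ _ (s , _ , s∉B , indBs) → maximal basis⊤ s ∈⊤ s∉B indBs))

  extension-isFlat : ∀ {Z b} → IsFlat M Z → (b ≡ inside ⇔ S ⊆ Z) → IsFlat extension (Z ∷ʳ b)
  extension-isFlat {Z} {b} flat inside⇔S⊆Z with basis M indep? Z
  ... | B , basisB = basis⇒isFlat extension (liftBasis basisB notExtensible) extend
    where
    notExtensible : b ≡ inside → ¬ Extensible M S B
    notExtensible b≡inside (s , s∈S , s∉B , indBs) =
      maximal basisB s (Equivalence.to inside⇔S⊆Z b≡inside s∈S) s∉B indBs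

    extendOld : ∀ {j} → j ∉ Z → Indep M (B ∪ ⁅ j ⁆)
    extendOld = isFlat⇒indep-∪⁅⁆ M indep? flat (basis⊆ basisB) (indep basisB)

    S⊈Z : fromℕ n ∉ Z ∷ʳ b → ¬ S ⊆ Z
    S⊈Z e∉Z S⊆Z = e∉Z (subst (λ b → fromℕ n ∈ Z ∷ʳ b) (sym (Equivalence.from inside⇔S⊆Z S⊆Z))
                                (fromℕ∈∷ʳinside Z))

    extend : ∀ x → x ∉ Z ∷ʳ b → Indep extension ((B ∷ʳ outside) ∪ ⁅ x ⁆)
    extend x x∉Z with view x
    ... | ‵inject₁ j = subst Indep⁺ (sym (∷ʳ-∪⁅inject₁⁆ B outside j))
                         (Indep⁺-∷ʳ⁺ (extendOld (x∉Z ∘ inject₁∈∷ʳ⁺)))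
    ... | ‵fromℕ with p⊈q⇒∃∈p∉q (S⊈Z x∉Z)
    ...   | s , s∈S , s∉Z = subst Indep⁺ (sym (∷ʳ-∪⁅fromℕ⁆ B outside))
                              (Indep⁺-∷ʳ⁺ (indep basisB , s , s∈S , s∉Z ∘ basis⊆ basisB , extendOld s∉Z))

module _ {n : ℕ} (N : Matroid (suc n)) where

  deletion : Matroid n
  deletion = record
    { Indep   = λ p → Indep N (p ∷ʳ outside)
    ; indep-∅ = subst (Indep N) (∅≡∅∷ʳoutside n) (indep-∅ N)
    ; indep-⊆ = λ p⊆q → indep-⊆ N (∷ʳoutside-⊆⁺ (inject₁∈∷ʳ⁺ ∘ p⊆q))
    ; augment = augment⁻
    }
    where
    augment⁻ : ∀ {p q} → Indep N (p ∷ʳ outside) → Indep N (q ∷ʳ outside) → ∣ p ∣ < ∣ q ∣ →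
               ∃ λ x → x ∈ q × x ∉ p × Indep N ((p ∪ ⁅ x ⁆) ∷ʳ outside)
    augment⁻ {p} {q} indp indq ∣p∣<∣q∣
      with augment N indp indq (subst₂ _<_ (sym (∣p∷ʳoutside∣ p)) (sym (∣p∷ʳoutside∣ q)) ∣p∣<∣q∣)
    ... | x , x∈q , x∉p , indpx with view x
    ...   | ‵fromℕ     = contradiction x∈q fromℕ∉∷ʳoutside
    ...   | ‵inject₁ j = j , inject₁∈∷ʳ⁻ x∈q , x∉p ∘ inject₁∈∷ʳ⁺ ,
                         subst (Indep N) (∷ʳ-∪⁅inject₁⁆ p outside j) indpx

  module _ (indep? : Decidable (Indep N)) where

    deletion-indep? : Decidable (Indep deletion)
    deletion-indep? p = indep? (p ∷ʳ outside)

    deletion-isFlat : ∀ {Z b} → IsFlat N (Z ∷ʳ b) → IsFlat deletion Z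
    deletion-isFlat {Z} flat with basis deletion deletion-indep? Z
    ... | B , basisB = basis⇒isFlat deletion basisB λ x x∉Z →
      subst (Indep N) (∷ʳ-∪⁅inject₁⁆ B outside x)
        (isFlat⇒indep-∪⁅⁆ N indep? flat (∷ʳoutside-⊆⁺ (inject₁∈∷ʳ⁺ ∘ basis⊆ basisB)) (indep basisB)
           (x∉Z ∘ inject₁∈∷ʳ⁻))

    deletion-isRank≤ : ∀ {k} → IsRank N k → ∃ λ r → IsRank deletion r × r ≤ k
    deletion-isRank≤ (_ , maxN) with basis deletion deletion-indep? ⊤
    ... | B , basis⊤ = ∣ B ∣ , isRankOf-basis deletion basis⊤ ,
                       subst (_≤ _) (∣p∷ʳoutside∣ B) (maxN _ ⊆⊤ (indep basis⊤))

module _ {m n : ℕ} {X : Pattern m n} {X' : Pattern m (suc n)} (appends : AppendsColumn X X') where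

  appended-isRowZeroSet : ∀ {i Z b} → IsRowZeroSet X' i (Z ∷ʳ b) → IsRowZeroSet X i Z
  appended-isRowZeroSet {i} zerosZ' j =
    (λ j∈Z → trans (sym (appends i j)) (proj₁ (zerosZ' (inject₁ j)) (inject₁∈∷ʳ⁺ j∈Z))) ,
    (λ Xij≡zero → inject₁∈∷ʳ⁻ (proj₂ (zerosZ' (inject₁ j)) (trans (appends i j) Xij≡zero)))

  last∈zeroSet⇔S⊆Z : ∀ {S i Z b} → NewColumnIsIntersection X X' S → IsRowZeroSet X' i (Z ∷ʳ b) →
                     b ≡ inside ⇔ S ⊆ Z
  last∈zeroSet⇔S⊆Z {S} {i} {Z} {b} intersection zerosZ' = mk⇔ to from
    where
    zerosZ = appended-isRowZeroSet zerosZ'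
    to : b ≡ inside → S ⊆ Z
    to refl {j} j∈S =
      proj₂ (zerosZ j) (proj₁ (intersection i) (proj₁ (zerosZ' (fromℕ n)) (fromℕ∈∷ʳinside Z)) j j∈S)
    from : S ⊆ Z → b ≡ inside
    from S⊆Z = fromℕ∈∷ʳ⁻ (proj₂ (zerosZ' (fromℕ n))
                 (proj₂ (intersection i) λ j j∈S → proj₁ (zerosZ j) (S⊆Z j∈S)))

  deletion-inR : ∀ {N} → Decidable (Indep N) → InR X' N → InR X (deletion N)
  deletion-inR {N} indep? inR' i Z zerosZ with initLast (zeroSet (X' i))
  ... | Z₀ , b , eq =
    let zerosZ' = subst (IsRowZeroSet X' i) eq (isRowZeroSet-zeroSet X' i)
    in subst (IsFlat (deletion N)) (isRowZeroSet-unique {X = X} (appended-isRowZeroSet zerosZ') zerosZ)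
         (deletion-isFlat N indep? (inR' i _ zerosZ'))

  extension-inR : ∀ {S M} (indep? : Decidable (Indep M)) → NewColumnIsIntersection X X' S → InR X M →
                  InR X' (PrincipalExtension.extension M indep? S)
  extension-inR indep? intersection inR i Z' zerosZ' with initLast Z'
  ... | Z , b , refl = PrincipalExtension.extension-isFlat _ indep? _
                         (inR i Z (appended-isRowZeroSet zerosZ')) (last∈zeroSet⇔S⊆Z intersection zerosZ')

theorem4p8 : ∀ {m n} (X : Pattern m n) (X' : Pattern m (suc n)) (S : Subset n) →
    AppendsColumn X X' → NewColumnIsIntersection X X' S →
    Σ ℕ λ k → IsMR X k × IsMR X' k
theorem4p8 X X' S appends intersection with minimumRank X
... | k , (M , indep? , inR , rank) , lowerBound =
  k , ((M , inR , rank) , lowerBound) ,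
  ((extension , extension-inR appends indep? intersection inR , extension-isRank rank) , lowerBound')
  where
  open PrincipalExtension M indep? S
  lowerBound' : RankLowerBound X' k
  lowerBound' = rankLowerBound-decidable X' k λ N indep?N k' inR' rank' →
    let r , rankDeletion , r≤k' = deletion-isRank≤ N indep?N rank'
    in ≤-trans (lowerBound (deletion N) r (deletion-inR appends {N} indep?N inR') rankDeletion) r≤k'
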